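{- Let $n_1,n_2\ge 2$ be integers and let $S_{n_1,n_2}$ be the double star graph. Then the characteristic polynomial $\det(xI-AD(S_{n_1,n_2}))$ of its adjacency-diametrical matrix is \[x^{n_1+n_2-4}\left(x^4-\left(9n_1n_2-8n_1-8n_2+8\right)x^2+4\left(n_1n_2-n_1-n_2+1\right)\right).\]
   Context: All graphs are finite, simple and undirected. The star graph $S_k$ is the graph on $k$ vertices consisting of one center joined to $k-1$ pendant vertices. The double star $S_{n_1,n_2}$ is obtained from two disjoint stars $S_{n_1}$ and $S_{n_2}$ by joining their centers by an edge (so it has $n_1+n_2$ vertices). For a connected graph $G$ with vertex set $\{v_1,\dots,v_n\}$ and diameter $d$, with $d_G(u,v)$ the distance, the adjacency-diametrical matrix $AD(G)$ is the $n\times n$ matrix whose $(i,j)$-entry is $1$ if $d_G(v_i,v_j)=1$, is $d$ if $d_G(v_i,v_j)=d$, and $0$ otherwise. -}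

module Defs where

open import Data.Nat as ℕ using (ℕ; zero; suc; _≡ᵇ_; _<ᵇ_; _⊔_)
open import Data.Bool using (Bool; true; false; _∧_; _∨_; if_then_else_)
open import Data.Fin using (Fin; zero; suc; toℕ; punchIn)
open import Data.Integer as ℤ using (ℤ; +_; -_; _-_)

Graph : ℕ → Set
Graph n = Fin n → Fin n → Bool

sumFin : ∀ {n} → (Fin n → ℤ) → ℤ
sumFin {zero}  f = + 0
sumFin {suc n} f = f zero ℤ.+ sumFin (λ i → f (suc i))

anyFin : ∀ {n} → (Fin n → Bool) → Bool
anyFin {zero}  f = false
anyFin {suc n} f = f zero ∨ anyFin (λ i → f (suc i))

maxFin : ∀ {n} → (Fin n → ℕ) → ℕ
maxFin {zero}  f = 0
maxFin {suc n} f = f zero ⊔ maxFin (λ i → f (suc i))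

reach : ∀ {n} → Graph n → ℕ → Fin n → Fin n → Bool
reach G zero    u v = toℕ u ≡ᵇ toℕ v
reach G (suc k) u v = reach G k u v ∨ anyFin (λ w → reach G k u w ∧ G w v)

-- distance d_G(u,v): least k with a walk of length ≤ k from u to v
-- (for connected graphs on n vertices it is found among 0..n)
dist : ∀ {n} → Graph n → Fin n → Fin n → ℕ
dist {n} G u v = go n 0
  where
  go : ℕ → ℕ → ℕ
  go zero    k = k
  go (suc f) k = if reach G k u v then k else go f (suc k)

diam : ∀ {n} → Graph n → ℕ
diam G = maxFin (λ u → maxFin (λ v → dist G u v))

AD : ∀ {n} → Graph n → Fin n → Fin n → ℕ
AD G u v =
  if dist G u v ≡ᵇ 1 then 1
  else if dist G u v ≡ᵇ diam G then diam G
  else 0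

det : ∀ n → (Fin n → Fin n → ℤ) → ℤ
det zero    M = + 1
det (suc n) M =
  sumFin (λ j → ((- + 1) ℤ.^ toℕ j) ℤ.* (M zero j ℤ.* det n (λ i k → M (suc i) (punchIn j k))))

charPolyAt : ∀ {n} → (Fin n → Fin n → ℕ) → ℤ → ℤ
charPolyAt {n} M x =
  det n (λ i j → (if toℕ i ≡ᵇ toℕ j then x else + 0) - + M i j)

-- Double star S_{n1,n2} on vertices Fin (n1 + n2):
-- vertex 0 is the centre of S_{n1} with pendant vertices 1 .. n1-1,
-- vertex n1 is the centre of S_{n2} with pendant vertices n1+1 .. n1+n2-1,
-- and the two centres 0, n1 are joined.
dsEdge : ℕ → ℕ → ℕ → Bool
dsEdge n1 a b =
  ((a ≡ᵇ 0) ∧ ((0 <ᵇ b) ∧ (b <ᵇ n1)))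
  ∨ ((a ≡ᵇ n1) ∧ (n1 <ᵇ b))
  ∨ ((a ≡ᵇ 0) ∧ (b ≡ᵇ n1))

doubleStar : ∀ n1 n2 → Graph (n1 ℕ.+ n2)
doubleStar n1 n2 u v = dsEdge n1 (toℕ u) (toℕ v) ∨ dsEdge n1 (toℕ v) (toℕ u)

{-# OPTIONS --safe #-}
-- A vertex of S_{n₁,n₂} is one of the two hubs or a leaf of one of the two stars, and the
-- AD-entry of two vertices depends only on these parts: 1 for an edge, 3 (the diameter)
-- for leaves of different stars, 0 otherwise.  Two leaves of the same star are twins:
-- their rows in xI − AD differ only on the diagonal.  The determinant is affine in each
-- diagonal entry, so with D(k) the determinant for k + 1 twin leaves and E(k) the same with
-- the diagonal entry of one twin replaced by 0, D(k + 1) = x D(k) + E(k + 1); zeroing the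
-- diagonal entry of a second twin makes two rows equal, so E(k + 1) = x E(k), and
-- D(k) = x^k (D(0) + k E(0)).  Doing this for both stars leaves four determinants of the
-- pattern of S_{2,2}, all instances of one 4 × 4 determinant with variable diagonal.

module Submission where

open import Defs
open import Data.Nat as ℕ using (ℕ; _≤_; _∸_)
open import Data.Integer as ℤ using (ℤ; +_; _+_; _-_; _*_; _^_)
open import Relation.Binary.PropositionalEquality using (_≡_)

open import Data.Nat using (zero; suc; _≡ᵇ_; _<ᵇ_; z≤n; s≤s)
import Data.Nat.Properties as ℕP
open import Data.Integer using (-_)
import Data.Integer.Properties as ℤP
open import Data.Integer.Tactic.RingSolver using (solve-∀)
open import Data.Bool using (Bool; true; false; if_then_else_; _∧_; _∨_; T)
open import Data.Bool.Properties using (∨-identityʳ; ∨-zeroʳ; ∧-zeroʳ)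
open import Data.Empty using (⊥-elim)
open import Data.Fin using (Fin; zero; suc; toℕ; punchIn; inject₁; _↑ʳ_; _≟_)
open import Data.Fin.Patterns using (0F; 1F; 2F; 3F; 4F)
open import Data.Vec.Functional using (_∷_; [])
import Data.Fin.Properties as FinP
open import Data.Product using (∃; _,_)
open import Function using (_∘_)
open import Relation.Binary.PropositionalEquality
  using (refl; sym; trans; cong; cong₂; subst; _≢_; module ≡-Reasoning)
open import Relation.Nullary using (yes; no)
open import Algebra.Properties.Semiring.Sum ℤP.+-*-semiring
  using (sum; sum-cong-≗; sum-remove; ∑-distrib-+; *-distribˡ-sum)

sumFin≡sum : ∀ {n} (f : Fin n → ℤ) → sumFin f ≡ sum f
sumFin≡sum {zero}  f = refl
sumFin≡sum {suc n} f = cong (_+_ (f zero)) (sumFin≡sum (f ∘ suc))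

sumFin-cong : ∀ {n} {f g : Fin n → ℤ} → (∀ i → f i ≡ g i) → sumFin f ≡ sumFin g
sumFin-cong {f = f} {g} f≗g =
  trans (sumFin≡sum f) (trans (sum-cong-≗ f≗g) (sym (sumFin≡sum g)))

sumFin-zero : ∀ {n} {f : Fin n → ℤ} → (∀ i → f i ≡ + 0) → sumFin f ≡ + 0
sumFin-zero {zero}  f≗0 = refl
sumFin-zero {suc n} f≗0 = cong₂ _+_ (f≗0 zero) (sumFin-zero (f≗0 ∘ suc))

sumFin-distrib-+ : ∀ {n} (f g : Fin n → ℤ) → sumFin (λ i → f i + g i) ≡ sumFin f + sumFin g
sumFin-distrib-+ f g
  rewrite sumFin≡sum (λ i → f i + g i) | sumFin≡sum f | sumFin≡sum g = ∑-distrib-+ f g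

*-distribˡ-sumFin : ∀ {n} (c : ℤ) (f : Fin n → ℤ) → c * sumFin f ≡ sumFin (λ i → c * f i)
*-distribˡ-sumFin c f
  rewrite sumFin≡sum f | sumFin≡sum (λ i → c * f i) = *-distribˡ-sum c f

sumFin-remove : ∀ {n} (k : Fin (suc n)) (f : Fin (suc n) → ℤ) →
                sumFin f ≡ f k + sumFin (f ∘ punchIn k)
sumFin-remove k f
  rewrite sumFin≡sum f | sumFin≡sum (f ∘ punchIn k) = sum-remove {i = k} f

-- Determinants: linearity and alternation in the rows

Matrix : ℕ → Set
Matrix n = Fin n → Fin n → ℤ

minor : ∀ {n} → Fin (suc n) → Fin (suc n) → Matrix (suc n) → Matrix n
minor r s M i j = M (punchIn r i) (punchIn s j)

sgn : ℕ → ℤ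
sgn k = (- + 1) ^ k

sgn-double : ∀ k → sgn (k ℕ.+ k) ≡ + 1
sgn-double zero    = refl
sgn-double (suc k) rewrite ℕP.+-suc k k | sgn-double k = refl

-- det (suc n) M is by definition sumFin (expansionTerm M).
expansionTerm : ∀ {n} → Matrix (suc n) → Fin (suc n) → ℤ
expansionTerm {n} M j = sgn (toℕ j) * (M zero j * det n (minor zero j M))

det-cong : ∀ n {M N : Matrix n} → (∀ i j → M i j ≡ N i j) → det n M ≡ det n N
det-cong zero    M≗N = refl
det-cong (suc n) M≗N = sumFin-cong λ j →
  cong₂ (λ a d → sgn (toℕ j) * (a * d)) (M≗N zero j) (det-cong n λ i k → M≗N (suc i) (punchIn j k))

term-vanishes : ∀ s a {d} → d ≡ + 0 → s * (a * d) ≡ + 0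
term-vanishes s a refl rewrite ℤP.*-zeroʳ a = ℤP.*-zeroʳ s

det-zero-row : ∀ n (r : Fin n) (M : Matrix n) → (∀ j → M r j ≡ + 0) → det n M ≡ + 0
det-zero-row (suc n) zero    M row≡0 = sumFin-zero λ j →
  trans (cong (λ a → sgn (toℕ j) * (a * det n (minor zero j M))) (row≡0 j)) (ℤP.*-zeroʳ (sgn (toℕ j)))
det-zero-row (suc n) (suc r) M row≡0 = sumFin-zero λ j →
  term-vanishes (sgn (toℕ j)) (M zero j) (det-zero-row n r (minor zero j M) (row≡0 ∘ punchIn j))

det-linear-row : ∀ n (r : Fin n) (M A B : Matrix n) →
                 (∀ j → M r j ≡ A r j + B r j) →
                 (∀ i → i ≢ r → ∀ j → A i j ≡ M i j) →
                 (∀ i → i ≢ r → ∀ j → B i j ≡ M i j) →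
                 det n M ≡ det n A + det n B
det-linear-row (suc n) zero M A B row A-off B-off =
  trans (sumFin-cong term) (sumFin-distrib-+ (expansionTerm A) (expansionTerm B))
  where
  distrib : ∀ s a b d → s * ((a + b) * d) ≡ s * (a * d) + s * (b * d)
  distrib = solve-∀
  same-minor : ∀ {N} → (∀ i → i ≢ zero → ∀ j → N i j ≡ M i j) →
               ∀ j → det n (minor zero j M) ≡ det n (minor zero j N)
  same-minor N-off j = det-cong n λ i k → sym (N-off (suc i) (λ ()) (punchIn j k))
  term : ∀ j → expansionTerm M j ≡ expansionTerm A j + expansionTerm B j
  term j =
    trans (cong (λ a → sgn (toℕ j) * (a * det n (minor zero j M))) (row j))
          (trans (distrib (sgn (toℕ j)) (A zero j) (B zero j) (det n (minor zero j M)))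
                 (cong₂ (λ dA dB → sgn (toℕ j) * (A zero j * dA) + sgn (toℕ j) * (B zero j * dB))
                        (same-minor A-off j) (same-minor B-off j)))
det-linear-row (suc n) (suc r) M A B row A-off B-off =
  trans (sumFin-cong term) (sumFin-distrib-+ (expansionTerm A) (expansionTerm B))
  where
  distrib : ∀ s a b d → s * (a * (b + d)) ≡ s * (a * b) + s * (a * d)
  distrib = solve-∀
  below : ∀ {i} → i ≢ r → suc i ≢ suc r
  below i≢r = i≢r ∘ FinP.suc-injective
  term : ∀ j → expansionTerm M j ≡ expansionTerm A j + expansionTerm B j
  term j =
    trans (cong (λ d → sgn (toℕ j) * (M zero j * d)) minor-split)
          (trans (distrib (sgn (toℕ j)) (M zero j) (det n (minor zero j A)) (det n (minor zero j B)))
                 (cong₂ (λ a b → sgn (toℕ j) * (a * det n (minor zero j A)) + sgn (toℕ j) * (b * det n (minor zero j B)))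
                        (sym (A-off zero (λ ()) j)) (sym (B-off zero (λ ()) j))))
    where
    minor-split : det n (minor zero j M) ≡ det n (minor zero j A) + det n (minor zero j B)
    minor-split = det-linear-row n r (minor zero j M) (minor zero j A) (minor zero j B)
                    (row ∘ punchIn j)
                    (λ i i≢r k → A-off (suc i) (below i≢r) (punchIn j k))
                    (λ i i≢r k → B-off (suc i) (below i≢r) (punchIn j k))

-- (j , k) ↦ (punchIn j k , swapIndex j k) exchanges the two columns j and punchIn j k
-- deleted by two successive first-row expansions.
swapIndex : ∀ {m} → Fin (suc m) → Fin m → Fin m
swapIndex {suc m} zero    k       = zero
swapIndex {suc m} (suc j) zero    = j
swapIndex {suc m} (suc j) (suc k) = suc (swapIndex j k)

punchIn-swapIndex : ∀ {m} (j : Fin (suc m)) (k : Fin m) → punchIn (punchIn j k) (swapIndex j k) ≡ j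
punchIn-swapIndex {suc m} zero    k       = refl
punchIn-swapIndex {suc m} (suc j) zero    = refl
punchIn-swapIndex {suc m} (suc j) (suc k) = cong suc (punchIn-swapIndex j k)

punchIn-punchIn-swapIndex : ∀ {m} (j : Fin (suc (suc m))) (k : Fin (suc m)) (l : Fin m) →
  punchIn (punchIn j k) (punchIn (swapIndex j k) l) ≡ punchIn j (punchIn k l)
punchIn-punchIn-swapIndex zero    k       l       = refl
punchIn-punchIn-swapIndex (suc j) zero    l       = refl
punchIn-punchIn-swapIndex {suc m} (suc j) (suc k) zero    = refl
punchIn-punchIn-swapIndex {suc m} (suc j) (suc k) (suc l) = cong suc (punchIn-punchIn-swapIndex j k l)

sgn-swapIndex : ∀ {m} (j : Fin (suc m)) (k : Fin m) →
  sgn (toℕ (punchIn j k)) * sgn (toℕ (swapIndex j k)) ≡ - (sgn (toℕ j) * sgn (toℕ k))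
sgn-swapIndex {suc m} zero    k       = lemma (sgn (toℕ k))
  where lemma : ∀ t → ((- + 1) * t) * + 1 ≡ - (+ 1 * t)
        lemma = solve-∀
sgn-swapIndex {suc m} (suc j) zero    = lemma (sgn (toℕ j))
  where lemma : ∀ s → + 1 * s ≡ - (((- + 1) * s) * + 1)
        lemma = solve-∀
sgn-swapIndex {suc m} (suc j) (suc k) =
  trans (lemma (sgn (toℕ (punchIn j k))) (sgn (toℕ (swapIndex j k))))
        (trans (sgn-swapIndex j k) (cong -_ (sym (lemma (sgn (toℕ j)) (sgn (toℕ k))))))
  where lemma : ∀ a b → ((- + 1) * a) * ((- + 1) * b) ≡ a * b
        lemma = solve-∀

sumFin-antisymmetric : ∀ {m} (F : Fin (suc m) → Fin m → ℤ) →
  (∀ j k → F j k ≡ - F (punchIn j k) (swapIndex j k)) → sumFin (λ j → sumFin (F j)) ≡ + 0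
sumFin-antisymmetric {zero}  F anti = refl
sumFin-antisymmetric {suc m} F anti = begin
  sumFin (F zero) + sumFin (λ j → F (suc j) zero + sumFin (F′ j))
    ≡⟨ cong (_+_ (sumFin (F zero))) (sumFin-distrib-+ (λ j → F (suc j) zero) (sumFin ∘ F′)) ⟩
  sumFin (F zero) + (sumFin (λ j → F (suc j) zero) + sumFin (λ j → sumFin (F′ j)))
    ≡⟨ sym (ℤP.+-assoc (sumFin (F zero)) _ _) ⟩
  (sumFin (F zero) + sumFin (λ j → F (suc j) zero)) + sumFin (λ j → sumFin (F′ j))
    ≡⟨ cong₂ _+_ (sym (sumFin-distrib-+ (F zero) (λ k → F (suc k) zero))) (sumFin-antisymmetric F′ λ j k → anti (suc j) (suc k)) ⟩
  sumFin (λ k → F zero k + F (suc k) zero) + + 0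
    ≡⟨ cong (_+ + 0) (sumFin-zero λ k → trans (cong (_+ F (suc k) zero) (anti zero k)) (ℤP.+-inverseˡ (F (suc k) zero))) ⟩
  + 0 ∎
  where
  open ≡-Reasoning
  F′ : Fin (suc m) → Fin m → ℤ
  F′ j k = F (suc j) (suc k)

det-equal-adjacent-rows : ∀ n (i : Fin n) (M : Matrix (suc n)) →
                          (∀ j → M (inject₁ i) j ≡ M (suc i) j) → det (suc n) M ≡ + 0
det-equal-adjacent-rows (suc m) zero M rows =
  trans (sumFin-cong expand) (sumFin-antisymmetric F anti)
  where
  D : Fin (suc (suc m)) → Fin (suc m) → ℤ
  D j k = det m (λ a b → M (suc (suc a)) (punchIn j (punchIn k b)))
  F : Fin (suc (suc m)) → Fin (suc m) → ℤ
  F j k = sgn (toℕ j) * (M zero j * (sgn (toℕ k) * (M (suc zero) (punchIn j k) * D j k)))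
  expand : ∀ j → expansionTerm M j ≡ sumFin (F j)
  expand j = trans (cong (sgn (toℕ j) *_) (*-distribˡ-sumFin (M zero j) (expansionTerm (minor zero j M))))
                   (*-distribˡ-sumFin (sgn (toℕ j)) (λ k → M zero j * expansionTerm (minor zero j M) k))
  reorder : ∀ s a t b d → s * (a * (t * (b * d))) ≡ (s * t) * (a * b * d)
  reorder = solve-∀
  reorder′ : ∀ p q a b d → (p * q) * (a * b * d) ≡ p * (b * (q * (a * d)))
  reorder′ = solve-∀
  anti : ∀ j k → F j k ≡ - F (punchIn j k) (swapIndex j k)
  anti j k = begin
    F j k
      ≡⟨ cong (λ b → sgn (toℕ j) * (M zero j * (sgn (toℕ k) * (b * D j k)))) (sym (rows (punchIn j k))) ⟩
    s * (a * (t * (b * D j k)))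
      ≡⟨ reorder s a t b (D j k) ⟩
    (s * t) * (a * b * D j k)
      ≡⟨ cong (λ z → z * (a * b * D j k)) (sym (ℤP.neg-involutive (s * t))) ⟩
    - - (s * t) * (a * b * D j k)
      ≡⟨ cong (λ z → - z * (a * b * D j k)) (sym (sgn-swapIndex j k)) ⟩
    - (p * q) * (a * b * D j k)
      ≡⟨ sym (ℤP.neg-distribˡ-* (p * q) _) ⟩
    - ((p * q) * (a * b * D j k))
      ≡⟨ cong -_ (reorder′ p q a b (D j k)) ⟩
    - (p * (b * (q * (a * D j k))))
      ≡⟨ cong₂ (λ c e → - (p * (b * (q * (c * e)))))
               (trans (rows j) (cong (M (suc zero)) (sym (punchIn-swapIndex j k))))
               (det-cong m λ a b → cong (M (suc (suc a))) (sym (punchIn-punchIn-swapIndex j k b))) ⟩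
    - F (punchIn j k) (swapIndex j k) ∎
    where
    open ≡-Reasoning
    s = sgn (toℕ j)
    t = sgn (toℕ k)
    p = sgn (toℕ (punchIn j k))
    q = sgn (toℕ (swapIndex j k))
    a = M zero j
    b = M zero (punchIn j k)
det-equal-adjacent-rows (suc m) (suc i) M rows = sumFin-zero λ j →
  term-vanishes (sgn (toℕ j)) (M zero j)
    (det-equal-adjacent-rows m i (minor zero j M) (rows ∘ punchIn j))

det-single-entry-row : ∀ n (r k : Fin (suc n)) (M : Matrix (suc n)) {c : ℤ} →
                       M r k ≡ c → (∀ j → M r (punchIn k j) ≡ + 0) →
                       det (suc n) M ≡ sgn (toℕ r ℕ.+ toℕ k) * (c * det n (minor r k M))
det-single-entry-row n zero k M refl row≡0 =
  trans (sumFin-remove k (expansionTerm M))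
        (trans (cong (_+_ (expansionTerm M k))
                     (sumFin-zero λ j → trans (cong (λ a → sgn (toℕ (punchIn k j)) * (a * det n (minor zero (punchIn k j) M))) (row≡0 j))
                                              (ℤP.*-zeroʳ (sgn (toℕ (punchIn k j))))))
               (ℤP.+-identityʳ _))
det-single-entry-row (suc m) (suc r) k M {c} Mrk≡c row≡0 =
  begin
    det (suc (suc m)) M
  ≡⟨ sumFin-remove k (expansionTerm M) ⟩
    expansionTerm M k + sumFin (expansionTerm M ∘ punchIn k)
  ≡⟨ cong₂ _+_ column-k-vanishes (sumFin-cong term) ⟩
    + 0 + sumFin (λ j → sgn (suc (toℕ r ℕ.+ toℕ k)) * (c * expansionTerm N j))
  ≡⟨ ℤP.+-identityˡ (sumFin (λ j → sgn (suc (toℕ r ℕ.+ toℕ k)) * (c * expansionTerm N j))) ⟩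
    sumFin (λ j → sgn (suc (toℕ r ℕ.+ toℕ k)) * (c * expansionTerm N j))
  ≡⟨ sym (trans (cong (sgn (suc (toℕ r ℕ.+ toℕ k)) *_) (*-distribˡ-sumFin c (expansionTerm N)))
                (*-distribˡ-sumFin (sgn (suc (toℕ r ℕ.+ toℕ k))) (λ j → c * expansionTerm N j))) ⟩
    sgn (suc (toℕ r ℕ.+ toℕ k)) * (c * det (suc m) N)
  ∎
  where
  open ≡-Reasoning
  N : Matrix (suc m)
  N = minor (suc r) k M
  column-k-vanishes : expansionTerm M k ≡ + 0
  column-k-vanishes = term-vanishes (sgn (toℕ k)) (M zero k) (det-zero-row (suc m) r (minor zero k M) row≡0)
  shuffle : ∀ p q s t u a d → p * q ≡ - (t * u) →
            p * (a * ((s * q) * (c * d))) ≡ ((- + 1) * (s * t)) * (c * (u * (a * d)))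
  shuffle p q s t u a d pq≡ = begin
    p * (a * ((s * q) * (c * d)))   ≡⟨ lhs p q s a c d ⟩
    (p * q) * (s * a * c * d)       ≡⟨ cong (_* (s * a * c * d)) pq≡ ⟩
    - (t * u) * (s * a * c * d)     ≡⟨ rhs t u s a c d ⟩
    ((- + 1) * (s * t)) * (c * (u * (a * d))) ∎
    where
    lhs : ∀ p q s a c d → p * (a * ((s * q) * (c * d))) ≡ (p * q) * (s * a * c * d)
    lhs = solve-∀
    rhs : ∀ t u s a c d → - (t * u) * (s * a * c * d) ≡ ((- + 1) * (s * t)) * (c * (u * (a * d)))
    rhs = solve-∀
  term : ∀ j → expansionTerm M (punchIn k j) ≡ sgn (suc (toℕ r ℕ.+ toℕ k)) * (c * expansionTerm N j)
  term j =
    begin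
      sgn (toℕ (punchIn k j)) * (M zero (punchIn k j) * det (suc m) (minor zero (punchIn k j) M))
    ≡⟨ cong (λ d → sgn (toℕ (punchIn k j)) * (M zero (punchIn k j) * d))
            (det-single-entry-row m r (swapIndex k j) (minor zero (punchIn k j) M)
               (trans (cong (M (suc r)) (punchIn-swapIndex k j)) Mrk≡c)
               (λ l → trans (cong (M (suc r)) (punchIn-punchIn-swapIndex k j l)) (row≡0 (punchIn j l)))) ⟩
      sgn (toℕ (punchIn k j)) * (M zero (punchIn k j) *
        (sgn (toℕ r ℕ.+ toℕ (swapIndex k j)) * (c * det m (minor r (swapIndex k j) (minor zero (punchIn k j) M)))))
    ≡⟨ cong₂ (λ s d → sgn (toℕ (punchIn k j)) * (M zero (punchIn k j) * (s * (c * d))))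
             (ℤP.^-distribˡ-+-* (- + 1) (toℕ r) (toℕ (swapIndex k j)))
             (det-cong m λ a b → cong (M (suc (punchIn r a))) (punchIn-punchIn-swapIndex k j b)) ⟩
      sgn (toℕ (punchIn k j)) * (M zero (punchIn k j) *
        ((sgn (toℕ r) * sgn (toℕ (swapIndex k j))) * (c * det m (minor zero j N))))
    ≡⟨ shuffle (sgn (toℕ (punchIn k j))) (sgn (toℕ (swapIndex k j))) (sgn (toℕ r)) (sgn (toℕ k)) (sgn (toℕ j))
               (M zero (punchIn k j)) (det m (minor zero j N)) (sgn-swapIndex k j) ⟩
      ((- + 1) * (sgn (toℕ r) * sgn (toℕ k))) * (c * expansionTerm N j)
    ≡⟨ cong (λ s → ((- + 1) * s) * (c * expansionTerm N j)) (sym (ℤP.^-distribˡ-+-* (- + 1) (toℕ r) (toℕ k))) ⟩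
      sgn (suc (toℕ r ℕ.+ toℕ k)) * (c * expansionTerm N j)
    ∎

-- The left-hand sides of the unfold identities below are first-row expansions as det
-- evaluates them (sgn 0 = + 1, sgn 1 = - + 1, det 0 = + 1, empty sums + 0).
laplace₂ : Matrix 2 → ℤ
laplace₂ M = M 0F 0F * M 1F 1F - M 0F 1F * M 1F 0F

laplace₃ : Matrix 3 → ℤ
laplace₃ M = M 0F 0F * laplace₂ (minor 0F 0F M) - M 0F 1F * laplace₂ (minor 0F 1F M) + M 0F 2F * laplace₂ (minor 0F 2F M)

laplace₄ : Matrix 4 → ℤ
laplace₄ M = M 0F 0F * laplace₃ (minor 0F 0F M) - M 0F 1F * laplace₃ (minor 0F 1F M)
           + M 0F 2F * laplace₃ (minor 0F 2F M) - M 0F 3F * laplace₃ (minor 0F 3F M)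

det₂ : ∀ M → det 2 M ≡ laplace₂ M
det₂ M = unfold (M 0F 0F) (M 0F 1F) (M 1F 1F) (M 1F 0F)
  where unfold : ∀ a b d c → + 1 * (a * (+ 1 * (d * + 1) + + 0)) + (- + 1 * (b * (+ 1 * (c * + 1) + + 0)) + + 0) ≡ a * d - b * c
        unfold = solve-∀

det₃ : ∀ M → det 3 M ≡ laplace₃ M
det₃ M = trans (unfold (M 0F 0F) (M 0F 1F) (M 0F 2F) (det 2 (minor 0F 0F M)) (det 2 (minor 0F 1F M)) (det 2 (minor 0F 2F M)))
               (cong₂ (λ A B → A + M 0F 2F * B)
                      (cong₂ (λ A B → M 0F 0F * A - M 0F 1F * B) (det₂ (minor 0F 0F M)) (det₂ (minor 0F 1F M)))
                      (det₂ (minor 0F 2F M)))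
  where unfold : ∀ a b c A B C → + 1 * (a * A) + (- + 1 * (b * B) + (+ 1 * (c * C) + + 0)) ≡ a * A - b * B + c * C
        unfold = solve-∀

det₄ : ∀ M → det 4 M ≡ laplace₄ M
det₄ M = trans (unfold (M 0F 0F) (M 0F 1F) (M 0F 2F) (M 0F 3F)
                       (det 3 (minor 0F 0F M)) (det 3 (minor 0F 1F M)) (det 3 (minor 0F 2F M)) (det 3 (minor 0F 3F M)))
               (cong₂ (λ A B → A - M 0F 3F * B)
                      (cong₂ (λ A B → A + M 0F 2F * B)
                             (cong₂ (λ A B → M 0F 0F * A - M 0F 1F * B) (det₃ (minor 0F 0F M)) (det₃ (minor 0F 1F M)))
                             (det₃ (minor 0F 2F M)))
                      (det₃ (minor 0F 3F M)))
  where unfold : ∀ a b c d A B C D → + 1 * (a * A) + (- + 1 * (b * B) + (+ 1 * (c * C) + (- + 1 * (d * D) + + 0)))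
                                     ≡ a * A - b * B + c * C - d * D
        unfold = solve-∀

≡ᵇ-refl : ∀ m → (m ≡ᵇ m) ≡ true
≡ᵇ-refl zero    = refl
≡ᵇ-refl (suc m) = ≡ᵇ-refl m

toℕ-≡ᵇ-true : ∀ {n} {i j : Fin n} → (toℕ i ≡ᵇ toℕ j) ≡ true → i ≡ j
toℕ-≡ᵇ-true {i = i} {j} eq = FinP.toℕ-injective (ℕP.≡ᵇ⇒≡ (toℕ i) (toℕ j) (subst T (sym eq) _))

toℕ-≡ᵇ-≢ : ∀ {n} {i j : Fin n} → i ≢ j → (toℕ i ≡ᵇ toℕ j) ≡ false
toℕ-≡ᵇ-≢ {i = i} {j} i≢j with toℕ i ≡ᵇ toℕ j in eq
... | false = refl
... | true  = ⊥-elim (i≢j (toℕ-≡ᵇ-true eq))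

toℕ-≡ᵇ-punchIn : ∀ {n} (r : Fin (suc n)) (a b : Fin n) →
                 (toℕ (punchIn r a) ≡ᵇ toℕ (punchIn r b)) ≡ (toℕ a ≡ᵇ toℕ b)
toℕ-≡ᵇ-punchIn zero    a       b       = refl
toℕ-≡ᵇ-punchIn (suc r) zero    zero    = refl
toℕ-≡ᵇ-punchIn (suc r) zero    (suc b) = refl
toℕ-≡ᵇ-punchIn (suc r) (suc a) zero    = refl
toℕ-≡ᵇ-punchIn (suc r) (suc a) (suc b) = toℕ-≡ᵇ-punchIn r a b

charMat : ∀ {n} → (Fin n → ℤ) → Matrix n → Matrix n
charMat d A i j = (if toℕ i ≡ᵇ toℕ j then d i else + 0) - A i j

det-charMat-affine : ∀ n (r : Fin (suc n)) (c : ℤ) (d d′ : Fin (suc n) → ℤ) (A : Matrix (suc n)) →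
  d r ≡ c + d′ r → (∀ i → i ≢ r → d i ≡ d′ i) →
  det (suc n) (charMat d A) ≡ c * det n (charMat (d ∘ punchIn r) (minor r r A)) + det (suc n) (charMat d′ A)
det-charMat-affine n r c d d′ A d-at-r d-off-r =
  begin
    det (suc n) (charMat d A)
  ≡⟨ det-linear-row (suc n) r (charMat d A) E (charMat d′ A) split E-off d′-off ⟩
    det (suc n) E + det (suc n) (charMat d′ A)
  ≡⟨ cong (_+ det (suc n) (charMat d′ A)) E-expand ⟩
    c * det n (charMat (d ∘ punchIn r) (minor r r A)) + det (suc n) (charMat d′ A)
  ∎
  where
  open ≡-Reasoning
  E : Matrix (suc n)
  E i j = if toℕ i ≡ᵇ toℕ r then (if toℕ i ≡ᵇ toℕ j then c else + 0) else charMat d A i j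
  split : ∀ j → charMat d A r j ≡ E r j + charMat d′ A r j
  split j rewrite ≡ᵇ-refl (toℕ r) with toℕ r ≡ᵇ toℕ j
  ... | true  rewrite d-at-r = shift c (d′ r) (A r j)
    where shift : ∀ c e a → (c + e) - a ≡ c + (e - a)
          shift = solve-∀
  ... | false = sym (ℤP.+-identityˡ (+ 0 - A r j))
  E-off : ∀ i → i ≢ r → ∀ j → E i j ≡ charMat d A i j
  E-off i i≢r j rewrite toℕ-≡ᵇ-≢ i≢r = refl
  d′-off : ∀ i → i ≢ r → ∀ j → charMat d′ A i j ≡ charMat d A i j
  d′-off i i≢r j rewrite d-off-r i i≢r = refl
  E-expand : det (suc n) E ≡ c * det n (charMat (d ∘ punchIn r) (minor r r A))
  E-expand =
    begin
      det (suc n) E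
    ≡⟨ det-single-entry-row n r r E E-rr E-row ⟩
      sgn (toℕ r ℕ.+ toℕ r) * (c * det n (minor r r E))
    ≡⟨ cong₂ (λ s e → s * (c * e)) (sgn-double (toℕ r)) (det-cong n minor-E) ⟩
      + 1 * (c * det n (charMat (d ∘ punchIn r) (minor r r A)))
    ≡⟨ ℤP.*-identityˡ _ ⟩
      c * det n (charMat (d ∘ punchIn r) (minor r r A))
    ∎
    where
    E-rr : E r r ≡ c
    E-rr rewrite ≡ᵇ-refl (toℕ r) = refl
    E-row : ∀ j → E r (punchIn r j) ≡ + 0
    E-row j rewrite ≡ᵇ-refl (toℕ r) | toℕ-≡ᵇ-≢ (FinP.punchInᵢ≢i r j ∘ sym) = refl
    minor-E : ∀ a b → minor r r E a b ≡ charMat (d ∘ punchIn r) (minor r r A) a b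
    minor-E a b rewrite toℕ-≡ᵇ-≢ (FinP.punchInᵢ≢i r a) | toℕ-≡ᵇ-punchIn r a b = refl

det-charMat-twins : ∀ n (i : Fin n) (d : Fin (suc n) → ℤ) (A : Matrix (suc n)) →
  d (inject₁ i) ≡ + 0 → d (suc i) ≡ + 0 → (∀ j → A (inject₁ i) j ≡ A (suc i) j) →
  det (suc n) (charMat d A) ≡ + 0
det-charMat-twins n i d A dᵢ≡0 dᵢ₊₁≡0 rows =
  det-equal-adjacent-rows n i (charMat d A) λ j →
    cong₂ _-_ (trans (if-zero (toℕ (inject₁ i) ≡ᵇ toℕ j) dᵢ≡0) (sym (if-zero (suc (toℕ i) ≡ᵇ toℕ j) dᵢ₊₁≡0))) (rows j)
  where
  if-zero : ∀ b {z} → z ≡ + 0 → (if b then z else + 0) ≡ + 0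
  if-zero true  z≡0 = z≡0
  if-zero false _   = refl

det-charMat-cong-diagonal : ∀ n {d d′ : Fin n → ℤ} (A : Matrix n) → (∀ i → d i ≡ d′ i) →
                            det n (charMat d A) ≡ det n (charMat d′ A)
det-charMat-cong-diagonal n A d≗d′ =
  det-cong n λ i j → cong (λ e → (if toℕ i ≡ᵇ toℕ j then e else + 0) - A i j) (d≗d′ i)

data Part : Set where
  hub₁ leaf₁ hub₂ leaf₂ : Part

pastHub₁ : ℕ → ℕ → Part
pastHub₁ zero    zero    = hub₂
pastHub₁ zero    (suc k) = leaf₂
pastHub₁ (suc m) zero    = leaf₁
pastHub₁ (suc m) (suc k) = pastHub₁ m k

-- The vertex at position k of a double star whose first star has m leaves: position 0 is
-- the first hub, 1 … m its leaves, m + 1 the second hub, and every later position a leaf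
-- of the second star.
layout : ℕ → ℕ → Part
layout m zero    = hub₁
layout m (suc k) = pastHub₁ m k

-- Distance between two distinct vertices with the given parts (distinct vertices never share a hub).
partDist : Part → Part → ℕ
partDist hub₁  hub₁  = 0
partDist hub₁  leaf₁ = 1
partDist hub₁  hub₂  = 1
partDist hub₁  leaf₂ = 2
partDist leaf₁ hub₁  = 1
partDist leaf₁ leaf₁ = 2
partDist leaf₁ hub₂  = 2
partDist leaf₁ leaf₂ = 3
partDist hub₂  hub₁  = 1
partDist hub₂  leaf₁ = 2
partDist hub₂  hub₂  = 0
partDist hub₂  leaf₂ = 1
partDist leaf₂ hub₁  = 2
partDist leaf₂ leaf₁ = 3
partDist leaf₂ hub₂  = 1
partDist leaf₂ leaf₂ = 2

-- AD G u v is by definition adValue (diam G) (dist G u v).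
adValue : ℕ → ℕ → ℕ
adValue diameter d = if d ≡ᵇ 1 then 1 else if d ≡ᵇ diameter then diameter else 0

adWeight : Part → Part → ℕ
adWeight p q = adValue 3 (partDist p q)

isHub₁ isLeaf₁ isHub₂ isLeaf₂ : Part → Bool
isHub₁ hub₁ = true
isHub₁ _    = false
isLeaf₁ leaf₁ = true
isLeaf₁ _     = false
isHub₂ hub₂ = true
isHub₂ _    = false
isLeaf₂ leaf₂ = true
isLeaf₂ _     = false

-- dsEdge read on parts instead of positions.
starEdge : Part → Part → Bool
starEdge p q = (isHub₁ p ∧ isLeaf₁ q) ∨ (isHub₂ p ∧ isLeaf₂ q) ∨ (isHub₁ p ∧ isHub₂ q)

adjacent : Part → Part → Bool
adjacent p q = starEdge p q ∨ starEdge q p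

isHub₁-layout : ∀ m k → (k ≡ᵇ 0) ≡ isHub₁ (layout m k)
isHub₁-layout m       zero    = refl
isHub₁-layout zero    (suc zero)    = refl
isHub₁-layout zero    (suc (suc k)) = refl
isHub₁-layout (suc m) (suc zero)    = refl
isHub₁-layout (suc m) (suc (suc k)) = isHub₁-layout m (suc k)

isLeaf₁-layout : ∀ m k → ((0 <ᵇ k) ∧ (k <ᵇ suc m)) ≡ isLeaf₁ (layout m k)
isLeaf₁-layout m       zero    = refl
isLeaf₁-layout zero    (suc zero)    = refl
isLeaf₁-layout zero    (suc (suc k)) = refl
isLeaf₁-layout (suc m) (suc zero)    = refl
isLeaf₁-layout (suc m) (suc (suc k)) = isLeaf₁-layout m (suc k)

isHub₂-layout : ∀ m k → (k ≡ᵇ suc m) ≡ isHub₂ (layout m k)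
isHub₂-layout m       zero    = refl
isHub₂-layout zero    (suc zero)    = refl
isHub₂-layout zero    (suc (suc k)) = refl
isHub₂-layout (suc m) (suc zero)    = refl
isHub₂-layout (suc m) (suc (suc k)) = isHub₂-layout m (suc k)

isLeaf₂-layout : ∀ m k → (suc m <ᵇ k) ≡ isLeaf₂ (layout m k)
isLeaf₂-layout m       zero    = refl
isLeaf₂-layout zero    (suc zero)    = refl
isLeaf₂-layout zero    (suc (suc k)) = refl
isLeaf₂-layout (suc m) (suc zero)    = refl
isLeaf₂-layout (suc m) (suc (suc k)) = isLeaf₂-layout m (suc k)

dsEdge-layout : ∀ m k l → dsEdge (suc m) k l ≡ starEdge (layout m k) (layout m l)
dsEdge-layout m k l
  rewrite isHub₁-layout m k | isHub₂-layout m k | isHub₂-layout m l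
        | isLeaf₁-layout m l | isLeaf₂-layout m l = refl

hub₁-position : ∀ m k → layout m k ≡ hub₁ → k ≡ 0
hub₁-position m k eq = ℕP.≡ᵇ⇒≡ k 0 (subst T (sym (trans (isHub₁-layout m k) (cong isHub₁ eq))) _)

hub₂-position : ∀ m k → layout m k ≡ hub₂ → k ≡ suc m
hub₂-position m k eq = ℕP.≡ᵇ⇒≡ k (suc m) (subst T (sym (trans (isHub₂-layout m k) (cong isHub₂ eq))) _)

layout-hub₂ : ∀ m → layout m (suc m) ≡ hub₂
layout-hub₂ zero    = refl
layout-hub₂ (suc m) = layout-hub₂ m

layout-leaf₂ : ∀ m → layout m (suc (suc m)) ≡ leaf₂
layout-leaf₂ zero    = refl
layout-leaf₂ (suc m) = layout-leaf₂ m

leaf₁-leaf₂-apart : ∀ p → adjacent leaf₁ p ≡ true → adjacent p leaf₂ ≡ false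
leaf₁-leaf₂-apart hub₁ _ = refl

leaf₂-leaf₁-apart : ∀ p → adjacent leaf₂ p ≡ true → adjacent p leaf₁ ≡ false
leaf₂-leaf₁-apart hub₂ _ = refl

partDist≤3 : ∀ p q → partDist p q ≤ 3
partDist≤3 p q = ℕP.≤ᵇ⇒≤ (partDist p q) 3 (bounded p q)
  where
  bounded : ∀ p q → T (partDist p q ℕ.≤ᵇ 3)
  bounded hub₁  hub₁  = _
  bounded hub₁  leaf₁ = _
  bounded hub₁  hub₂  = _
  bounded hub₁  leaf₂ = _
  bounded leaf₁ hub₁  = _
  bounded leaf₁ leaf₁ = _
  bounded leaf₁ hub₂  = _
  bounded leaf₁ leaf₂ = _
  bounded hub₂  hub₁  = _
  bounded hub₂  leaf₁ = _
  bounded hub₂  hub₂  = _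
  bounded hub₂  leaf₂ = _
  bounded leaf₂ hub₁  = _
  bounded leaf₂ leaf₁ = _
  bounded leaf₂ hub₂  = _
  bounded leaf₂ leaf₂ = _

adWeight-self : ∀ p → adWeight p p ≡ 0
adWeight-self hub₁  = refl
adWeight-self leaf₁ = refl
adWeight-self hub₂  = refl
adWeight-self leaf₂ = refl

-- Removing twin leaves

adPattern : ℕ → ∀ {n} → Matrix n
adPattern m i j = + adWeight (layout m (toℕ i)) (layout m (toℕ j))

puncture : (ℕ → Bool) → ℤ → ∀ {n} → Fin n → ℤ
puncture Z x i = if Z (toℕ i) then + 0 else x

∅ : ℕ → Bool
∅ _ = false

_∪｛_｝ : (ℕ → Bool) → ℕ → ℕ → Bool
(Z ∪｛ r ｝) k = Z k ∨ (k ≡ᵇ r)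

starCharMat : ℕ → (ℕ → Bool) → ℤ → ∀ {n} → Matrix n
starCharMat m Z x = charMat (puncture Z x) (adPattern m)

-- The split position is also passed as the number p, so that instances read Z ∪｛ 3 ｝ rather
-- than Z ∪｛ toℕ 3F ｝; Agda would compare the two only by unfolding det.
det-starCharMat-split : ∀ n (r : Fin (suc n)) p m m′ Z Z′ x → toℕ r ≡ p →
  Z p ≡ false →
  (∀ a → layout m (toℕ (punchIn r a)) ≡ layout m′ (toℕ a)) →
  (∀ a → Z (toℕ (punchIn r a)) ≡ Z′ (toℕ a)) →
  det (suc n) (starCharMat m Z x)
    ≡ x * det n (starCharMat m′ Z′ x) + det (suc n) (starCharMat m (Z ∪｛ p ｝) x)
det-starCharMat-split n r .(toℕ r) m m′ Z Z′ x refl Zr≡false layout-minor Z-minor =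
  trans (det-charMat-affine n r x (puncture Z x) (puncture (Z ∪｛ toℕ r ｝) x) (adPattern m) at-r off-r)
        (cong (λ d → x * d + det (suc n) (starCharMat m (Z ∪｛ toℕ r ｝) x)) (det-cong n minor≡))
  where
  at-r : puncture Z x r ≡ x + puncture (Z ∪｛ toℕ r ｝) x r
  at-r rewrite Zr≡false | ≡ᵇ-refl (toℕ r) = sym (ℤP.+-identityʳ x)
  off-r : ∀ i → i ≢ r → puncture Z x i ≡ puncture (Z ∪｛ toℕ r ｝) x i
  off-r i i≢r rewrite toℕ-≡ᵇ-≢ i≢r | ∨-identityʳ (Z (toℕ i)) = refl
  minor≡ : ∀ a b → charMat (puncture Z x ∘ punchIn r) (minor r r (adPattern m)) a b ≡ starCharMat m′ Z′ x a b
  minor≡ a b rewrite Z-minor a | layout-minor a | layout-minor b = refl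

det-starCharMat-twins : ∀ n (i : Fin n) m Z x →
  layout m (toℕ i) ≡ layout m (suc (toℕ i)) → Z (toℕ i) ≡ true → Z (suc (toℕ i)) ≡ true →
  det (suc n) (starCharMat m Z x) ≡ + 0
det-starCharMat-twins n i m Z x same-part Zᵢ Zᵢ₊₁ =
  det-charMat-twins n i (puncture Z x) (adPattern m) zero-at-i zero-at-i+1 λ j →
    cong (λ p → + adWeight p (layout m (toℕ j))) (trans (cong (layout m) (FinP.toℕ-inject₁ i)) same-part)
  where
  zero-at-i : puncture Z x (inject₁ i) ≡ + 0
  zero-at-i rewrite FinP.toℕ-inject₁ i | Zᵢ = refl
  zero-at-i+1 : puncture Z x (suc i) ≡ + 0
  zero-at-i+1 rewrite Zᵢ₊₁ = refl

twin-recurrence : ∀ (x : ℤ) (D E : ℕ → ℤ) →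
  (∀ k → D (suc k) ≡ x * D k + E (suc k)) → (∀ k → E (suc k) ≡ x * E k) →
  ∀ k → D k ≡ x ^ k * (D 0 + + k * E 0)
twin-recurrence x D E D-step E-step = D-closed
  where
  E-closed : ∀ k → E k ≡ x ^ k * E 0
  E-closed zero    = sym (ℤP.*-identityˡ (E 0))
  E-closed (suc k) = trans (E-step k) (trans (cong (x *_) (E-closed k)) (sym (ℤP.*-assoc x (x ^ k) (E 0))))
  step : ∀ x p d e k → x * (p * (d + k * e)) + (x * p) * e ≡ (x * p) * (d + (+ 1 + k) * e)
  step = solve-∀
  D-closed : ∀ k → D k ≡ x ^ k * (D 0 + + k * E 0)
  D-closed zero    = base (D 0) (E 0)
    where base : ∀ d e → d ≡ + 1 * (d + + 0 * e)
          base = solve-∀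
  D-closed (suc k) =
    trans (D-step k)
          (trans (cong₂ (λ d e → x * d + e) (D-closed k) (E-closed (suc k)))
                 (step x (x ^ k) (D 0) (E 0) (+ k)))

module FirstStarLeaves (N : ℕ) (x : ℤ) where

  D E : ℕ → ℤ
  D k = det (suc (suc k) ℕ.+ N) (starCharMat (suc k) ∅ x)
  E k = det (suc (suc k) ℕ.+ N) (starCharMat (suc k) (∅ ∪｛ 1 ｝) x)

  D-step : ∀ k → D (suc k) ≡ x * D k + E (suc k)
  D-step k = det-starCharMat-split (suc (suc k) ℕ.+ N) 1F 1 (suc (suc k)) (suc k) ∅ ∅ x refl refl
               (λ { 0F → refl ; (suc a) → refl }) (λ _ → refl)

  E-step : ∀ k → E (suc k) ≡ x * E k
  E-step k =
    trans (det-starCharMat-split (suc (suc k) ℕ.+ N) 2F 2 (suc (suc k)) (suc k) (∅ ∪｛ 1 ｝) (∅ ∪｛ 1 ｝) x refl refl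
             (λ { 0F → refl ; 1F → refl ; (suc (suc a)) → refl })
             (λ { 0F → refl ; 1F → refl ; (suc (suc a)) → refl }))
          (trans (cong (_+_ (x * E k)) (det-starCharMat-twins (suc (suc k) ℕ.+ N) 1F (suc (suc k)) ((∅ ∪｛ 1 ｝) ∪｛ 2 ｝) x refl refl refl))
                 (ℤP.+-identityʳ (x * E k)))

  closed-form : ∀ k → det (suc (suc k) ℕ.+ N) (starCharMat (suc k) ∅ x)
                      ≡ x ^ k * (det (2 ℕ.+ N) (starCharMat 1 ∅ x) + + k * det (2 ℕ.+ N) (starCharMat 1 (∅ ∪｛ 1 ｝) x))
  closed-form = twin-recurrence x D E D-step E-step

module SecondStarLeaves (Z : ℕ → Bool) (Z-small : ∀ k → Z (3 ℕ.+ k) ≡ false) (x : ℤ) where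

  D E : ℕ → ℤ
  D k = det (4 ℕ.+ k) (starCharMat 1 Z x)
  E k = det (4 ℕ.+ k) (starCharMat 1 (Z ∪｛ 3 ｝) x)

  D-step : ∀ k → D (suc k) ≡ x * D k + E (suc k)
  D-step k = det-starCharMat-split (4 ℕ.+ k) 3F 3 1 1 Z Z x refl (Z-small 0)
               (λ { 0F → refl ; 1F → refl ; 2F → refl ; (suc (suc (suc a))) → refl })
               (λ { 0F → refl ; 1F → refl ; 2F → refl
                  ; (suc (suc (suc a))) → trans (Z-small (suc (toℕ a))) (sym (Z-small (toℕ a))) })

  E-step : ∀ k → E (suc k) ≡ x * E k
  E-step k =
    trans (det-starCharMat-split (4 ℕ.+ k) 4F 4 1 1 (Z ∪｛ 3 ｝) (Z ∪｛ 3 ｝) x refl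
             (cong (_∨ false) (Z-small 1))
             (λ { 0F → refl ; 1F → refl ; 2F → refl ; 3F → refl
                ; (suc (suc (suc (suc a)))) → refl })
             (λ { 0F → refl ; 1F → refl ; 2F → refl ; 3F → refl
                ; (suc (suc (suc (suc a)))) → cong (_∨ false) (trans (Z-small (2 ℕ.+ toℕ a)) (sym (Z-small (suc (toℕ a))))) }))
          (trans (cong (_+_ (x * E k)) (det-starCharMat-twins (4 ℕ.+ k) 3F 1 ((Z ∪｛ 3 ｝) ∪｛ 4 ｝) x refl
                                       (cong (_∨ false) (∨-zeroʳ (Z 3))) (∨-zeroʳ (Z 4 ∨ false))))
                 (ℤP.+-identityʳ (x * E k)))

  closed-form : ∀ k → det (4 ℕ.+ k) (starCharMat 1 Z x)
                      ≡ x ^ k * (det 4 (starCharMat 1 Z x) + + k * det 4 (starCharMat 1 (Z ∪｛ 3 ｝) x))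
  closed-form = twin-recurrence x D E D-step E-step

s₂₂Poly : ℤ → ℤ → ℤ → ℤ → ℤ
s₂₂Poly d₀ d₁ d₂ d₃ = d₀ * d₁ * d₂ * d₃ - d₀ * d₁ - d₂ * d₃ - d₁ * d₃ - + 9 * (d₀ * d₂) + + 4

det-S₂₂ : ∀ d₀ d₁ d₂ d₃ → det 4 (charMat (d₀ ∷ d₁ ∷ d₂ ∷ d₃ ∷ []) (adPattern 1)) ≡ s₂₂Poly d₀ d₁ d₂ d₃
det-S₂₂ d₀ d₁ d₂ d₃ = trans (det₄ (charMat (d₀ ∷ d₁ ∷ d₂ ∷ d₃ ∷ []) (adPattern 1))) (expand d₀ d₁ d₂ d₃)
  where
  -- The let-bound copies of laplace₂ and laplace₃ are inlined, so the solver sees a polynomial.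
  expand : ∀ d₀ d₁ d₂ d₃ →
    let l₂ : ℤ → ℤ → ℤ → ℤ → ℤ
        l₂ a b c d = a * d - b * c
        l₃ : ℤ → ℤ → ℤ → ℤ → ℤ → ℤ → ℤ → ℤ → ℤ → ℤ
        l₃ a b c d e f g h i = a * l₂ e f h i - b * l₂ d f g i + c * l₂ d e g h
        x₀ = d₀ - + 0 ; x₁ = d₁ - + 0 ; x₂ = d₂ - + 0 ; x₃ = d₃ - + 0
        w₀ = + 0 - + 0 ; w₁ = + 0 - + 1 ; w₃ = + 0 - + 3
    in  x₀ * l₃ x₁ w₀ w₃ w₀ x₂ w₁ w₃ w₁ x₃
      - w₁ * l₃ w₁ w₀ w₃ w₁ x₂ w₁ w₀ w₁ x₃
      + w₁ * l₃ w₁ x₁ w₃ w₁ w₀ w₁ w₀ w₃ x₃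
      - w₀ * l₃ w₁ x₁ w₀ w₁ w₀ x₂ w₀ w₃ w₁
      ≡ d₀ * d₁ * d₂ * d₃ - d₀ * d₁ - d₂ * d₃ - d₁ * d₃ - + 9 * (d₀ * d₂) + + 4
  expand = solve-∀

det-starCharMat-S₂₂ : ∀ Z x → Z 0 ≡ false → Z 2 ≡ false →
  det 4 (starCharMat 1 Z x) ≡ s₂₂Poly x (puncture Z x {4} 1F) x (puncture Z x {4} 3F)
det-starCharMat-S₂₂ Z x Z₀ Z₂ =
  trans (det-charMat-cong-diagonal 4 (adPattern 1) diagonal)
        (det-S₂₂ x (puncture Z x {4} 1F) x (puncture Z x {4} 3F))
  where
  diagonal : ∀ i → puncture Z x i ≡ (x ∷ puncture Z x {4} 1F ∷ x ∷ puncture Z x {4} 3F ∷ []) i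
  diagonal 0F rewrite Z₀ = refl
  diagonal 1F = refl
  diagonal 2F rewrite Z₂ = refl
  diagonal 3F = refl

any-witness : ∀ {n} (g : Fin n → Bool) (w : Fin n) → g w ≡ true → anyFin g ≡ true
any-witness g zero    gw = cong (_∨ anyFin (λ i → g (suc i))) gw
any-witness g (suc w) gw = trans (cong (g zero ∨_) (any-witness (λ i → g (suc i)) w gw)) (∨-zeroʳ (g zero))

any-none : ∀ {n} (g : Fin n → Bool) → (∀ w → g w ≡ false) → anyFin g ≡ false
any-none {zero}  g none = refl
any-none {suc n} g none rewrite none zero = any-none (λ i → g (suc i)) (λ w → none (suc w))

any-at : ∀ {n} (u : Fin n) (f : Fin n → Bool) → anyFin (λ w → (toℕ u ≡ᵇ toℕ w) ∧ f w) ≡ f u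
any-at zero    f rewrite any-none (λ i → (0 ≡ᵇ toℕ (suc i)) ∧ f (suc i)) (λ _ → refl) = ∨-identityʳ (f zero)
any-at (suc u) f = any-at u (λ i → f (suc i))

module _ {n} (G : Graph n) where

  reach-one : ∀ u v → reach G 1 u v ≡ (toℕ u ≡ᵇ toℕ v) ∨ G u v
  reach-one u v = cong ((toℕ u ≡ᵇ toℕ v) ∨_) (any-at u (λ w → G w v))

  reach-step : ∀ {k} u w v → reach G k u w ≡ true → G w v ≡ true → reach G (suc k) u v ≡ true
  reach-step {k} u w v uw wv =
    trans (cong (reach G k u v ∨_) (any-witness (λ w → reach G k u w ∧ G w v) w (cong₂ _∧_ uw wv)))
          (∨-zeroʳ (reach G k u v))

  reach-pred-false : ∀ {k} u v → reach G (suc k) u v ≡ false → reach G k u v ≡ false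
  reach-pred-false {k} u v r with reach G k u v
  ... | false = refl

  reach-two-false : ∀ u v → (toℕ u ≡ᵇ toℕ v) ≡ false → G u v ≡ false →
                    (∀ w → G u w ≡ true → G w v ≡ false) → reach G 2 u v ≡ false
  reach-two-false u v u≠v uv no-common =
    cong₂ _∨_ (trans (reach-one u v) (cong₂ _∨_ u≠v uv))
              (any-none (λ w → reach G 1 u w ∧ G w v) no-walk)
    where
    no-walk : ∀ w → reach G 1 u w ∧ G w v ≡ false
    no-walk w rewrite reach-one u w with toℕ u ≡ᵇ toℕ w in u≡ᵇw | G u w in uw′
    ... | false | false = refl
    ... | _     | true  rewrite no-common w uw′ = ∧-zeroʳ _
    ... | true  | false = subst (λ w → G w v ≡ false) (toℕ-≡ᵇ-true u≡ᵇw) uv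

  reach-three-of-path : ∀ u w w′ v → G u w ≡ true → G w w′ ≡ true → G w′ v ≡ true → reach G 3 u v ≡ true
  reach-three-of-path u w w′ v uw ww′ w′v =
    reach-step {2} u w′ v (reach-step {1} u w w′ (reach-step {0} u u w (≡ᵇ-refl (toℕ u)) uw) ww′) w′v

-- The first four tries of the search in dist, which unfold definitionally on four or more vertices.
search : Bool → Bool → Bool → Bool → ℕ → ℕ
search b₀ b₁ b₂ b₃ rest = if b₀ then 0 else if b₁ then 1 else if b₂ then 2 else if b₃ then 3 else rest

dist-search : ∀ {n} → 4 ≤ n → (G : Graph n) (u v : Fin n) →
              ∃ λ rest → dist G u v ≡ search (reach G 0 u v) (reach G 1 u v) (reach G 2 u v) (reach G 3 u v) rest
dist-search (s≤s (s≤s (s≤s (s≤s _)))) G u v = _ , refl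

search-1 : ∀ b₀ b₁ b₂ b₃ rest → b₀ ≡ false → b₁ ≡ true → search b₀ b₁ b₂ b₃ rest ≡ 1
search-1 _ _ _ _ _ refl refl = refl

search-2 : ∀ b₀ b₁ b₂ b₃ rest → b₀ ≡ false → b₁ ≡ false → b₂ ≡ true → search b₀ b₁ b₂ b₃ rest ≡ 2
search-2 _ _ _ _ _ refl refl refl = refl

search-3 : ∀ b₀ b₁ b₂ b₃ rest → b₀ ≡ false → b₁ ≡ false → b₂ ≡ false → b₃ ≡ true → search b₀ b₁ b₂ b₃ rest ≡ 3
search-3 _ _ _ _ _ refl refl refl refl = refl

module _ {n} (4≤n : 4 ≤ n) (G : Graph n) where

  dist-self : ∀ u → dist G u u ≡ 0
  dist-self u with dist-search 4≤n G u u
  ... | rest , eq rewrite ≡ᵇ-refl (toℕ u) = eq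

  dist-adjacent : ∀ u v → u ≢ v → G u v ≡ true → dist G u v ≡ 1
  dist-adjacent u v u≢v uv with dist-search 4≤n G u v
  ... | rest , eq = trans eq (search-1 (reach G 0 u v) (reach G 1 u v) (reach G 2 u v) (reach G 3 u v) rest
                               (toℕ-≡ᵇ-≢ u≢v) (reach-step G {0} u u v (≡ᵇ-refl (toℕ u)) uv))

  dist-two-step : ∀ u w v → u ≢ v → G u v ≡ false → G u w ≡ true → G w v ≡ true → dist G u v ≡ 2
  dist-two-step u w v u≢v uv uw wv with dist-search 4≤n G u v
  ... | rest , eq = trans eq (search-2 (reach G 0 u v) (reach G 1 u v) (reach G 2 u v) (reach G 3 u v) rest
                               (reach-pred-false G {0} u v r₁) r₁ r₂)
    where r₁ : reach G 1 u v ≡ false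
          r₁ = trans (reach-one G u v) (cong₂ _∨_ (toℕ-≡ᵇ-≢ u≢v) uv)
          r₂ : reach G 2 u v ≡ true
          r₂ = reach-step G {1} u w v (reach-step G {0} u u w (≡ᵇ-refl (toℕ u)) uw) wv

  dist-three-step : ∀ u w w′ v → u ≢ v → G u v ≡ false → (∀ y → G u y ≡ true → G y v ≡ false) →
                    G u w ≡ true → G w w′ ≡ true → G w′ v ≡ true → dist G u v ≡ 3
  dist-three-step u w w′ v u≢v uv no-common uw ww′ w′v with dist-search 4≤n G u v
  ... | rest , eq = trans eq (search-3 (reach G 0 u v) (reach G 1 u v) (reach G 2 u v) (reach G 3 u v) rest
                               (reach-pred-false G {0} u v r₁) r₁ r₂ (reach-three-of-path G u w w′ v uw ww′ w′v))
    where r₂ : reach G 2 u v ≡ false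
          r₂ = reach-two-false G u v (toℕ-≡ᵇ-≢ u≢v) uv no-common
          r₁ : reach G 1 u v ≡ false
          r₁ = reach-pred-false G {1} u v r₂

maxFin-≤ : ∀ {n} (f : Fin n → ℕ) {m} → (∀ i → f i ≤ m) → maxFin f ≤ m
maxFin-≤ {zero}  f f≤m = z≤n
maxFin-≤ {suc n} f f≤m = ℕP.⊔-lub (f≤m zero) (maxFin-≤ (λ i → f (suc i)) (λ i → f≤m (suc i)))

≤-maxFin : ∀ {n} (f : Fin n → ℕ) i → f i ≤ maxFin f
≤-maxFin f zero    = ℕP.m≤m⊔n (f zero) _
≤-maxFin f (suc i) = ℕP.≤-trans (≤-maxFin (λ j → f (suc j)) i) (ℕP.m≤n⊔m (f zero) _)

maxFin-attained : ∀ {n} (f : Fin n → ℕ) {m} → (∀ i → f i ≤ m) → ∀ i → f i ≡ m → maxFin f ≡ m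
maxFin-attained f f≤m i refl = ℕP.≤-antisym (maxFin-≤ f f≤m) (≤-maxFin f i)

-- Distances in the double star

module DoubleStar (a b : ℕ) where

  n₁ n₂ : ℕ
  n₁ = suc (suc a)
  n₂ = suc (suc b)

  V : Set
  V = Fin (n₁ ℕ.+ n₂)

  G : Graph (n₁ ℕ.+ n₂)
  G = doubleStar n₁ n₂

  part : V → Part
  part u = layout (suc a) (toℕ u)

  4≤n : 4 ≤ n₁ ℕ.+ n₂
  4≤n = s≤s (s≤s (ℕP.≤-trans (s≤s (s≤s z≤n)) (ℕP.m≤n+m n₂ a)))

  adjacency : ∀ u v {p q} → part u ≡ p → part v ≡ q → G u v ≡ adjacent p q
  adjacency u v refl refl =
    cong₂ _∨_ (dsEdge-layout (suc a) (toℕ u) (toℕ v)) (dsEdge-layout (suc a) (toℕ v) (toℕ u))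

  centre₁ centre₂ leaf₁-vertex leaf₂-vertex : V
  centre₁      = zero
  centre₂      = n₁ ↑ʳ zero
  leaf₁-vertex = suc zero
  leaf₂-vertex = n₁ ↑ʳ suc zero

  part-centre₁ : part centre₁ ≡ hub₁
  part-centre₁ = refl

  part-centre₂ : part centre₂ ≡ hub₂
  part-centre₂ =
    trans (cong (layout (suc a)) (trans (FinP.toℕ-↑ʳ n₁ zero) (ℕP.+-identityʳ n₁))) (layout-hub₂ (suc a))

  part-leaf₂-vertex : part leaf₂-vertex ≡ leaf₂
  part-leaf₂-vertex =
    trans (cong (layout (suc a)) (trans (FinP.toℕ-↑ʳ n₁ (suc zero)) (ℕP.+-comm n₁ 1))) (layout-leaf₂ (suc a))

  same-hub₁ : ∀ {u v} → part u ≡ hub₁ → part v ≡ hub₁ → u ≡ v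
  same-hub₁ {u} {v} pu pv = FinP.toℕ-injective (trans (hub₁-position (suc a) (toℕ u) pu) (sym (hub₁-position (suc a) (toℕ v) pv)))

  same-hub₂ : ∀ {u v} → part u ≡ hub₂ → part v ≡ hub₂ → u ≡ v
  same-hub₂ {u} {v} pu pv = FinP.toℕ-injective (trans (hub₂-position (suc a) (toℕ u) pu) (sym (hub₂-position (suc a) (toℕ v) pv)))

  dist-via : ∀ {u v} w → u ≢ v → ∀ {p q r} → part u ≡ p → part v ≡ q → part w ≡ r →
             adjacent p q ≡ false → adjacent p r ≡ true → adjacent r q ≡ true → dist G u v ≡ 2
  dist-via {u} {v} w u≢v pu pv pw pq pr rq =
    dist-two-step 4≤n G u w v u≢v (trans (adjacency u v pu pv) pq) (trans (adjacency u w pu pw) pr) (trans (adjacency w v pw pv) rq)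

  dist-distinct : ∀ u v → u ≢ v → dist G u v ≡ partDist (part u) (part v)
  dist-distinct u v u≢v with part u in pu | part v in pv
  ... | hub₁  | hub₁  = ⊥-elim (u≢v (same-hub₁ pu pv))
  ... | hub₁  | leaf₁ = dist-adjacent 4≤n G u v u≢v (adjacency u v pu pv)
  ... | hub₁  | hub₂  = dist-adjacent 4≤n G u v u≢v (adjacency u v pu pv)
  ... | hub₁  | leaf₂ = dist-via centre₂ u≢v pu pv part-centre₂ refl refl refl
  ... | leaf₁ | hub₁  = dist-adjacent 4≤n G u v u≢v (adjacency u v pu pv)
  ... | leaf₁ | leaf₁ = dist-via centre₁ u≢v pu pv part-centre₁ refl refl refl
  ... | leaf₁ | hub₂  = dist-via centre₁ u≢v pu pv part-centre₁ refl refl refl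
  ... | leaf₁ | leaf₂ =
    dist-three-step 4≤n G u centre₁ centre₂ v u≢v (adjacency u v pu pv)
      (λ y uy → trans (adjacency y v refl pv) (leaf₁-leaf₂-apart (part y) (trans (sym (adjacency u y pu refl)) uy)))
      (adjacency u centre₁ pu part-centre₁) (adjacency centre₁ centre₂ part-centre₁ part-centre₂) (adjacency centre₂ v part-centre₂ pv)
  ... | hub₂  | hub₁  = dist-adjacent 4≤n G u v u≢v (adjacency u v pu pv)
  ... | hub₂  | leaf₁ = dist-via centre₁ u≢v pu pv part-centre₁ refl refl refl
  ... | hub₂  | hub₂  = ⊥-elim (u≢v (same-hub₂ pu pv))
  ... | hub₂  | leaf₂ = dist-adjacent 4≤n G u v u≢v (adjacency u v pu pv)
  ... | leaf₂ | hub₁  = dist-via centre₂ u≢v pu pv part-centre₂ refl refl refl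
  ... | leaf₂ | leaf₁ =
    dist-three-step 4≤n G u centre₂ centre₁ v u≢v (adjacency u v pu pv)
      (λ y uy → trans (adjacency y v refl pv) (leaf₂-leaf₁-apart (part y) (trans (sym (adjacency u y pu refl)) uy)))
      (adjacency u centre₂ pu part-centre₂) (adjacency centre₂ centre₁ part-centre₂ part-centre₁) (adjacency centre₁ v part-centre₁ pv)
  ... | leaf₂ | hub₂  = dist-adjacent 4≤n G u v u≢v (adjacency u v pu pv)
  ... | leaf₂ | leaf₂ = dist-via centre₂ u≢v pu pv part-centre₂ refl refl refl

  dist≤3 : ∀ u v → dist G u v ≤ 3
  dist≤3 u v with u ≟ v
  ... | yes refl = subst (_≤ 3) (sym (dist-self 4≤n G u)) z≤n
  ... | no u≢v   = subst (_≤ 3) (sym (dist-distinct u v u≢v)) (partDist≤3 (part u) (part v))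

  diam≡3 : diam G ≡ 3
  diam≡3 =
    maxFin-attained (λ u → maxFin (dist G u)) (λ u → maxFin-≤ (dist G u) (dist≤3 u)) leaf₁-vertex
      (maxFin-attained (dist G leaf₁-vertex) (dist≤3 leaf₁-vertex) leaf₂-vertex
        (trans (dist-distinct leaf₁-vertex leaf₂-vertex (λ ())) (cong (partDist leaf₁) part-leaf₂-vertex)))

  AD≡adWeight : ∀ u v → AD G u v ≡ adWeight (part u) (part v)
  AD≡adWeight u v with u ≟ v
  ... | yes refl = trans (cong₂ adValue diam≡3 (dist-self 4≤n G u)) (sym (adWeight-self (part u)))
  ... | no u≢v   = cong₂ adValue diam≡3 (dist-distinct u v u≢v)

  charPolyAt-AD : ∀ x → charPolyAt (AD G) x ≡ det (n₁ ℕ.+ n₂) (starCharMat (suc a) ∅ x)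
  charPolyAt-AD x = det-cong (n₁ ℕ.+ n₂) λ i j →
    cong (λ w → (if toℕ i ≡ᵇ toℕ j then x else + 0) - + w) (AD≡adWeight i j)

det-one-leaf₁ : ∀ Z → (∀ k → Z (3 ℕ.+ k) ≡ false) → Z 0 ≡ false → Z 2 ≡ false → ∀ b x →
  det (4 ℕ.+ b) (starCharMat 1 Z x)
    ≡ x ^ b * (s₂₂Poly x (puncture Z x {4} 1F) x (puncture Z x {4} 3F)
               + + b * s₂₂Poly x (puncture (Z ∪｛ 3 ｝) x {4} 1F) x (puncture (Z ∪｛ 3 ｝) x {4} 3F))
det-one-leaf₁ Z Z-small Z₀ Z₂ b x =
  trans (SecondStarLeaves.closed-form Z Z-small x b)
        (cong₂ (λ d e → x ^ b * (d + + b * e))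
               (det-starCharMat-S₂₂ Z x Z₀ Z₂)
               (det-starCharMat-S₂₂ (Z ∪｛ 3 ｝) x (cong (_∨ false) Z₀) (cong (_∨ false) Z₂)))

-- x ^ 4 and x ^ 2 appear unfolded: the ring solver does not recognise ℤ's _^_.
combine-closed-forms : ∀ x p q a b →
  let S : ℤ → ℤ → ℤ
      S u v = x * u * x * v - x * u - x * v - u * v - + 9 * (x * x) + + 4
  in  p * (q * (S x x + b * S x (+ 0)) + a * (q * (S (+ 0) x + b * S (+ 0) (+ 0))))
      ≡ (p * q) * (x * (x * (x * (x * + 1)))
                   - (+ 9 * (+ 2 + a) * (+ 2 + b) - + 8 * (+ 2 + a) - + 8 * (+ 2 + b) + + 8) * (x * (x * + 1))
                   + + 4 * ((+ 2 + a) * (+ 2 + b) - (+ 2 + a) - (+ 2 + b) + + 1))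
combine-closed-forms = solve-∀

mainTheorem3 : (n₁ n₂ : ℕ) → 2 ≤ n₁ → 2 ≤ n₂ → (x : ℤ) →
    charPolyAt (AD (doubleStar n₁ n₂)) x
      ≡ x ^ (n₁ ℕ.+ n₂ ∸ 4)
        * (x ^ 4
           - (+ 9 * + n₁ * + n₂ - + 8 * + n₁ - + 8 * + n₂ + + 8) * x ^ 2
           + + 4 * (+ n₁ * + n₂ - + n₁ - + n₂ + + 1))
mainTheorem3 (suc (suc a)) (suc (suc b)) (s≤s (s≤s _)) (s≤s (s≤s _)) x =
  begin
    charPolyAt (AD (doubleStar (suc (suc a)) (suc (suc b)))) x
  ≡⟨ DoubleStar.charPolyAt-AD a b x ⟩
    det (suc (suc a) ℕ.+ suc (suc b)) (starCharMat (suc a) ∅ x)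
  ≡⟨ FirstStarLeaves.closed-form (suc (suc b)) x a ⟩
    x ^ a * (det (4 ℕ.+ b) (starCharMat 1 ∅ x) + + a * det (4 ℕ.+ b) (starCharMat 1 (∅ ∪｛ 1 ｝) x))
  ≡⟨ cong₂ (λ d e → x ^ a * (d + + a * e))
           (det-one-leaf₁ ∅ (λ _ → refl) refl refl b x) (det-one-leaf₁ (∅ ∪｛ 1 ｝) (λ _ → refl) refl refl b x) ⟩
    x ^ a * (x ^ b * (S x x + + b * S x (+ 0)) + + a * (x ^ b * (S (+ 0) x + + b * S (+ 0) (+ 0))))
  ≡⟨ combine-closed-forms x (x ^ a) (x ^ b) (+ a) (+ b) ⟩
    (x ^ a * x ^ b) * target
  ≡⟨ cong (_* target) (sym (ℤP.^-distribˡ-+-* x a b)) ⟩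
    x ^ (a ℕ.+ b) * target
  ≡⟨ cong (λ k → x ^ k * target) (sym exponent) ⟩
    x ^ (suc (suc a) ℕ.+ suc (suc b) ∸ 4) * target
  ∎
  where
  open ≡-Reasoning
  S : ℤ → ℤ → ℤ
  S u v = s₂₂Poly x u x v
  n₁ n₂ : ℕ
  n₁ = suc (suc a)
  n₂ = suc (suc b)
  target : ℤ
  target = x ^ 4
           - (+ 9 * + n₁ * + n₂ - + 8 * + n₁ - + 8 * + n₂ + + 8) * x ^ 2
           + + 4 * (+ n₁ * + n₂ - + n₁ - + n₂ + + 1)
  exponent : suc (suc a) ℕ.+ suc (suc b) ∸ 4 ≡ a ℕ.+ b
  exponent = cong (_∸ 2) (trans (ℕP.+-suc a (suc b)) (cong suc (ℕP.+-suc a b)))
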